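{- Let $A$ be a finite non-empty set of agents, $b\in A$, and $\chi\in\mathcal{L}_{KS}$ with $\vdash_{\mathsf{SSL}}\chi\to K_b\chi$. Then $\vdash_{\mathsf{SSL}}\neg S_a\chi$ for every $a\in A$ with $a\neq b$. In particular, for all distinct $a,b\in A$ and every $\psi\in\mathcal{L}_{KS}$: $\vdash_{\mathsf{SSL}}\neg S_aK_b\psi$, $\vdash_{\mathsf{SSL}}\neg S_a\neg K_b\psi$, $\vdash_{\mathsf{SSL}}\neg S_aS_b\psi$, and $\vdash_{\mathsf{SSL}}\neg S_a\neg S_b\psi$.
   Context: The language $\mathcal{L}_{KS}$ over a countable set $\mathsf{Prop}$ of variables and agents $A$ is $\varphi::=p\mid\neg\varphi\mid(\varphi\wedge\varphi)\mid K_a\varphi\mid S_a\varphi$. The system $\mathsf{SSL}$ has axioms: all propositional tautologies; for each $a\in A$: (K) $K_a(\varphi\to\psi)\to(K_a\varphi\to K_a\psi)$, (T) $K_a\varphi\to\varphi$, (4) $K_a\varphi\to K_aK_a\varphi$, (5) $\neg K_a\varphi\to K_a\neg K_a\varphi$, (S1) $S_a\varphi\to K_a\varphi$, (S4) $S_a\varphi\to K_aS_a\varphi$; and for distinct $a,b\in A$: (S2) $S_a\varphi\to\neg K_b\varphi$. Rules: modus ponens; from $\varphi$ infer $K_a\varphi$; from $\vdash\varphi\leftrightarrow\psi$ infer $\vdash S_a\varphi\leftrightarrow S_a\psi$. -}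

module Defs where

open import Data.Nat using (ℕ; suc)
open import Data.Fin using (Fin)
open import Data.Bool using (Bool; true; false; not; _∧_)
open import Relation.Binary.PropositionalEquality using (_≡_)
open import Relation.Nullary using (¬_)

data Form (n : ℕ) : Set where
  var : ℕ → Form n
  ¬'_ : Form n → Form n
  _∧'_ : Form n → Form n → Form n
  K : Fin n → Form n → Form n
  S : Fin n → Form n → Form n

infixr 6 _∧'_
infixr 4 _→'_ _↔'_

_∨'_ : ∀ {n} → Form n → Form n → Form n
φ ∨' ψ = ¬' (¬' φ ∧' ¬' ψ)

_→'_ : ∀ {n} → Form n → Form n → Form n
φ →' ψ = ¬' (φ ∧' ¬' ψ)

_↔'_ : ∀ {n} → Form n → Form n → Form n
φ ↔' ψ = (φ →' ψ) ∧' (ψ →' φ)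

-- Propositional evaluation: modal formulas K_a φ, S_a φ are treated as atoms,
-- alongside the variables.  An assignment gives truth values to all such atoms.
record Assignment (n : ℕ) : Set where
  field
    atomV : ℕ → Bool
    kV    : Fin n → Form n → Bool
    sV    : Fin n → Form n → Bool

eval : ∀ {n} → Assignment n → Form n → Bool
eval v (var p)   = Assignment.atomV v p
eval v (¬' φ)    = not (eval v φ)
eval v (φ ∧' ψ)  = eval v φ ∧ eval v ψ
eval v (K a φ)   = Assignment.kV v a φ
eval v (S a φ)   = Assignment.sV v a φ

Tautology : ∀ {n} → Form n → Set
Tautology φ = ∀ v → eval v φ ≡ true

data ⊢_ {n : ℕ} : Form n → Set where
  taut : ∀ {φ} → Tautology φ → ⊢ φ
  axK  : ∀ a φ ψ → ⊢ (K a (φ →' ψ) →' (K a φ →' K a ψ))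
  axT  : ∀ a φ → ⊢ (K a φ →' φ)
  ax4  : ∀ a φ → ⊢ (K a φ →' K a (K a φ))
  ax5  : ∀ a φ → ⊢ (¬' K a φ →' K a (¬' K a φ))
  axS1 : ∀ a φ → ⊢ (S a φ →' K a φ)
  axS4 : ∀ a φ → ⊢ (S a φ →' K a (S a φ))
  axS2 : ∀ a b φ → ¬ (a ≡ b) → ⊢ (S a φ →' ¬' K b φ)
  mp   : ∀ {φ ψ} → ⊢ (φ →' ψ) → ⊢ φ → ⊢ ψ
  nec  : ∀ a {φ} → ⊢ φ → ⊢ K a φ
  reS  : ∀ a {φ ψ} → ⊢ (φ ↔' ψ) → ⊢ (S a φ ↔' S a ψ)

infix 2 ⊢_

-- If χ → K_b χ is derivable, then S_a χ yields K_a χ, hence χ by (T), hence K_b χ,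
-- while (S2) yields ¬K_b χ; so ¬S_a χ is derivable.  The four instances are the
-- positive and negative introspection principles for K_b (axioms 4 and 5) and for
-- S_b (axiom S4, and its negative form derived from 5, T and S4).
module Submission where

open import Defs
open import Data.Nat using (ℕ; suc)
open import Data.Fin using (Fin)
open import Data.Bool using (true; false)
open import Data.Product using (_×_; _,_)
open import Relation.Binary.PropositionalEquality using (_≡_; refl)
open import Relation.Nullary using (¬_)

module _ {n : ℕ} where

  →-trans : {φ ψ θ : Form n} → ⊢ (φ →' ψ) → ⊢ (ψ →' θ) → ⊢ (φ →' θ)
  →-trans {φ} {ψ} {θ} φ→ψ ψ→θ = mp (mp (taut syllogism) φ→ψ) ψ→θ
    where
    syllogism : Tautology ((φ →' ψ) →' (ψ →' θ) →' (φ →' θ))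
    syllogism v with eval v φ | eval v ψ | eval v θ
    ... | true  | true  | true  = refl
    ... | true  | true  | false = refl
    ... | true  | false | true  = refl
    ... | true  | false | false = refl
    ... | false | true  | true  = refl
    ... | false | true  | false = refl
    ... | false | false | true  = refl
    ... | false | false | false = refl

  contraposition : {φ ψ : Form n} → ⊢ (φ →' ψ) → ⊢ (¬' ψ →' ¬' φ)
  contraposition {φ} {ψ} φ→ψ = mp (taut transposition) φ→ψ
    where
    transposition : Tautology ((φ →' ψ) →' (¬' ψ →' ¬' φ))
    transposition v with eval v φ | eval v ψ
    ... | true  | true  = refl
    ... | true  | false = refl
    ... | false | true  = refl
    ... | false | false = refl

  reductio : {φ ψ : Form n} → ⊢ (φ →' ψ) → ⊢ (φ →' ¬' ψ) → ⊢ (¬' φ)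
  reductio {φ} {ψ} φ→ψ φ→¬ψ = mp (mp (taut absurdity) φ→ψ) φ→¬ψ
    where
    absurdity : Tautology ((φ →' ψ) →' (φ →' ¬' ψ) →' ¬' φ)
    absurdity v with eval v φ | eval v ψ
    ... | true  | true  = refl
    ... | true  | false = refl
    ... | false | true  = refl
    ... | false | false = refl

  K-mono : ∀ a {φ ψ : Form n} → ⊢ (φ →' ψ) → ⊢ (K a φ →' K a ψ)
  K-mono a {φ} {ψ} φ→ψ = mp (axK a φ ψ) (nec a φ→ψ)

  S→ : ∀ a (φ : Form n) → ⊢ (S a φ →' φ)
  S→ a φ = →-trans (axS1 a φ) (axT a φ)

  -- ¬S_b ψ → ¬K_b S_b ψ (S4), → K_b ¬K_b S_b ψ (5), → K_b ¬S_b ψ (T under K_b).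
  ¬S→K¬S : ∀ b (ψ : Form n) → ⊢ (¬' S b ψ →' K b (¬' S b ψ))
  ¬S→K¬S b ψ =
    →-trans (contraposition (axT b (S b ψ)))
      (→-trans (ax5 b (S b ψ)) (K-mono b (contraposition (axS4 b ψ))))

  ¬S-introspective : ∀ b (χ : Form n) → ⊢ (χ →' K b χ)
                   → ∀ a → ¬ (a ≡ b) → ⊢ (¬' S a χ)
  ¬S-introspective b χ χ→Kχ a a≢b =
    reductio (→-trans (S→ a χ) χ→Kχ) (axS2 a b χ a≢b)

proposition4p8 : (m : ℕ)
    → ((b : Fin (suc m)) (χ : Form (suc m)) → (⊢ (χ →' K b χ))
    → (a : Fin (suc m)) → ¬ (a ≡ b) → ⊢ (¬' S a χ))
    × ((a b : Fin (suc m)) → ¬ (a ≡ b) → (ψ : Form (suc m))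
    → (⊢ (¬' S a (K b ψ))) × (⊢ (¬' S a (¬' K b ψ)))
    × (⊢ (¬' S a (S b ψ))) × (⊢ (¬' S a (¬' S b ψ))))
proposition4p8 m = ¬S-introspective , λ a b a≢b ψ →
    ¬S-introspective b _ (ax4 b ψ) a a≢b ,
    ¬S-introspective b _ (ax5 b ψ) a a≢b ,
    ¬S-introspective b _ (axS4 b ψ) a a≢b ,
    ¬S-introspective b _ (¬S→K¬S b ψ) a a≢b
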